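{- For every positive integer $n$, any deterministic query algorithm that learns (always correctly outputs) a hidden matrix from $\mathcal{M}_n$ must make at least $\frac{n(n-1)}{2}$ edge queries on some input.
   Context: $\mathcal{M}_n$ is the set of all $n\times n$ permutation matrices (bipartite adjacency matrices of perfect matchings between two copies of $[n]$). An edge query on $(i,j)\in[n]\times[n]$ returns the entry $(i,j)$ of the hidden matrix. -}

module Defs where

open import Data.Nat using (ℕ; zero; suc)
open import Data.Bool using (Bool; true; false; if_then_else_)
open import Data.Fin using (Fin; _≟_)
open import Data.Fin.Permutation using (Permutation′; _⟨$⟩ʳ_)
open import Relation.Nullary.Decidable using (⌊_⌋)

-- An n×n 0/1 matrix (entries as Bool: true = 1).
Matrix : ℕ → Set
Matrix n = Fin n → Fin n → Bool

-- The permutation matrix of π : entry (i,j) is 1 iff π(i) = j.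
-- M_n is exactly the image of this map over all permutations of Fin n.
permMatrix : {n : ℕ} → Permutation′ n → Matrix n
permMatrix π i j = ⌊ π ⟨$⟩ʳ i ≟ j ⌋

-- A deterministic (adaptive) edge-query algorithm = a decision tree:
-- either stop and output a matrix, or query entry (i,j) and continue
-- depending on the answer.
data QueryAlg (n : ℕ) : Set where
  output : Matrix n → QueryAlg n
  query  : Fin n → Fin n → (Bool → QueryAlg n) → QueryAlg n

run : {n : ℕ} → QueryAlg n → Matrix n → Matrix n
run (output X) M = X
run (query i j k) M = run (k (M i j)) M

numQueries : {n : ℕ} → QueryAlg n → Matrix n → ℕ
numQueries (output X) M = zero
numQueries (query i j k) M = suc (numQueries (k (M i j)) M)

Learns : {n : ℕ} → QueryAlg n → Set
Learns {n} A = (π : Permutation′ n) → (i j : Fin n) →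
  run A (permMatrix π) i j ≡ permMatrix π i j
  where open import Relation.Binary.PropositionalEquality using (_≡_)

-- Adversary argument. The adversary maintains a bipartite graph G, initially
-- complete, such that the algorithm must be correct on every perfect matching
-- of G. To a query (a, b) it answers 0 and deletes the edge ab if G - ab still
-- has a perfect matching, and answers 1 otherwise (then every perfect matching
-- of G uses ab). So each query deletes at most one edge. When the algorithm
-- stops, its output agrees with every perfect matching of the final graph U,
-- so U has a unique perfect matching π. After permuting the columns of U by π,
-- no two edges ij and ji with i ≠ j remain (swapping them would give a second
-- perfect matching), so U has at most n(n+1)/2 edges and at least
-- n² - n(n+1)/2 = n(n-1)/2 queries were made.
module Submission where

open import Defs
open import Data.Bool using (Bool; true; false)
open import Data.Bool.Properties using () renaming (_≟_ to _≟ᵇ_)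
open import Data.Fin using (Fin; zero; suc; _≟_; punchIn; punchOut)
open import Data.Fin.Permutation
  using (Permutation; Permutation′; _⟨$⟩ʳ_; _≈_; id; insert; remove; insert-remove; transpose; _∘ₚ_)
import Data.Fin.Permutation.Components as PC
open import Data.Fin.Properties using (any?; all?; punchInᵢ≢i)
open import Data.Nat using (ℕ; zero; suc; _+_; _*_; _∸_; _/_; _≤_; z≤n; s≤s)
open import Data.Nat.DivMod using (/-monoˡ-≤; m*n/n≡m)
open import Data.Nat.Properties
  using ( +-0-commutativeMonoid; ≤-refl; ≤-trans; ≤-reflexive; n≤1+n; +-identityʳ; *-comm
        ; *-distribˡ-+; +-mono-≤; +-monoʳ-≤; *-monoʳ-≤; +-cancelʳ-≤; module ≤-Reasoning)
open import Data.Nat.Tactic.RingSolver using (solve-∀)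
open import Algebra.Properties.CommutativeMonoid.Sum +-0-commutativeMonoid
  using (sum; sum-syntax; sum-remove; sum-cong-≗; ∑-distrib-+; ∑-comm; ∑-permute)
open import Data.Product using (∃; Σ-syntax; _×_; _,_)
open import Function using (_∘_; Injection)
open import Function.Properties.Inverse using (↔⇒↣)
open import Level using (Level)
open import Relation.Binary.PropositionalEquality
open import Relation.Nullary using (Dec; yes; no; ¬_; contradiction)
open import Relation.Nullary.Decidable using (map′; dec-true; decidable-stable)
open import Relation.Unary using (Pred; Decidable)

private
  variable
    n : ℕ
    p : Level

sum-mono-≤ : (f g : Fin n → ℕ) → (∀ i → f i ≤ g i) → sum f ≤ sum g
sum-mono-≤ {zero}  f g f≤g = z≤n
sum-mono-≤ {suc n} f g f≤g = +-mono-≤ (f≤g zero) (sum-mono-≤ (f ∘ suc) (g ∘ suc) (f≤g ∘ suc))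

sum-const : ∀ n c → ∑[ i < n ] c ≡ n * c
sum-const zero    c = refl
sum-const (suc n) c = cong (c +_) (sum-const n c)

sum-ones : ∀ n → ∑[ i < n ] 1 ≡ n
sum-ones zero    = refl
sum-ones (suc n) = cong suc (sum-ones n)

sum-≤-suc : (f g : Fin n → ℕ) (a : Fin n) → (∀ i → i ≢ a → f i ≤ g i) → f a ≤ suc (g a) →
            sum f ≤ suc (sum g)
sum-≤-suc {suc n} f g a f≤g fa≤ = begin
  sum f                                    ≡⟨ sum-remove f ⟩
  f a + ∑[ i < n ] f (punchIn a i)         ≤⟨ +-mono-≤ fa≤ (sum-mono-≤ _ _ rest≤) ⟩
  suc (g a + ∑[ i < n ] g (punchIn a i))   ≡⟨ cong suc (sum-remove g) ⟨
  suc (sum g)                              ∎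
  where
  open ≤-Reasoning
  rest≤ : ∀ i → f (punchIn a i) ≤ g (punchIn a i)
  rest≤ i = f≤g _ (punchInᵢ≢i a i)

boolToℕ : Bool → ℕ
boolToℕ true  = 1
boolToℕ false = 0

boolToℕ≤1 : ∀ x → boolToℕ x ≤ 1
boolToℕ≤1 true  = ≤-refl
boolToℕ≤1 false = z≤n

boolToℕ-+-≤1 : ∀ x y → ¬ (x ≡ true × y ≡ true) → boolToℕ x + boolToℕ y ≤ 1
boolToℕ-+-≤1 true  true  notBoth = contradiction (refl , refl) notBoth
boolToℕ-+-≤1 true  false _       = ≤-refl
boolToℕ-+-≤1 false y     _       = boolToℕ≤1 y

degree : Matrix n → Fin n → ℕ
degree {n} G i = ∑[ j < n ] boolToℕ (G i j)

edgeCount : Matrix n → ℕ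
edgeCount {n} G = ∑[ i < n ] degree G i

complete : Matrix n
complete _ _ = true

edgeCount-complete : ∀ n → edgeCount (complete {n}) ≡ n * n
edgeCount-complete n = trans (sum-cong-≗ {n} λ _ → sum-ones n) (sum-const n n)

edgeCount-permuteColumns : (π : Permutation′ n) (G : Matrix n) →
                           edgeCount G ≡ edgeCount (λ i j → G i (π ⟨$⟩ʳ j))
edgeCount-permuteColumns {n} π G = sum-cong-≗ {n} (λ i → ∑-permute (boolToℕ ∘ G i) π)

edgeCount-antisymmetric : (G : Matrix n) → (∀ i j → G i j ≡ true → G j i ≡ true → i ≡ j) →
                          2 * edgeCount G ≤ n * suc n
edgeCount-antisymmetric {n} G antisym = begin
  2 * edgeCount G                                            ≡⟨ cong (edgeCount G +_) (+-identityʳ _) ⟩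
  edgeCount G + edgeCount G                                  ≡⟨ cong (edgeCount G +_) (∑-comm e) ⟩
  ∑[ i < n ] ∑[ j < n ] e i j + ∑[ i < n ] ∑[ j < n ] e j i  ≡⟨ ∑-distrib-+ {n} _ _ ⟨
  ∑[ i < n ] (∑[ j < n ] e i j + ∑[ j < n ] e j i)           ≡⟨ sum-cong-≗ {n} inner-distrib ⟨
  ∑[ i < n ] ∑[ j < n ] (e i j + e j i)                      ≤⟨ sum-mono-≤ _ _ row≤ ⟩
  ∑[ i < n ] suc (∑[ j < n ] 1)                              ≡⟨ sum-cong-≗ {n} (λ _ → cong suc (sum-ones n)) ⟩
  ∑[ i < n ] suc n                                           ≡⟨ sum-const n (suc n) ⟩
  n * suc n                                                  ∎
  where
  open ≤-Reasoning
  e : Fin n → Fin n → ℕ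
  e i j = boolToℕ (G i j)
  inner-distrib : ∀ i → ∑[ j < n ] (e i j + e j i) ≡ ∑[ j < n ] e i j + ∑[ j < n ] e j i
  inner-distrib i = ∑-distrib-+ (e i) (λ j → e j i)
  offDiagonal : ∀ i j → j ≢ i → e i j + e j i ≤ 1
  offDiagonal i j j≢i = boolToℕ-+-≤1 (G i j) (G j i) (λ (gij , gji) → j≢i (sym (antisym i j gij gji)))
  diagonal : ∀ i → e i i + e i i ≤ 2
  diagonal i = +-mono-≤ (boolToℕ≤1 (G i i)) (boolToℕ≤1 (G i i))
  row≤ : ∀ i → ∑[ j < n ] (e i j + e j i) ≤ suc (∑[ j < n ] 1)
  row≤ i = sum-≤-suc _ _ i (offDiagonal i) (diagonal i)

insert-cong : ∀ {m n} i j {σ ρ : Permutation m n} → σ ≈ ρ → insert i j σ ≈ insert i j ρ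
insert-cong i j σ≈ρ k with i ≟ k
... | yes _   = refl
... | no i≢k = cong (punchIn j) (σ≈ρ (punchOut i≢k))

anyPermutation? : {P : Pred (Permutation′ n) p} →
                  (∀ {σ ρ} → σ ≈ ρ → P σ → P ρ) → Decidable P → Dec (∃ P)
anyPermutation? {zero}  resp P? = map′ (id ,_) (λ (π , Pπ) → resp (λ ()) Pπ) (P? id)
anyPermutation? {suc n} resp P? =
  map′ (λ (j , σ , Pσ) → insert zero j σ , Pσ)
       (λ (π , Pπ) → π ⟨$⟩ʳ zero , remove zero π , resp (sym ∘ insert-remove zero π) Pπ)
       (any? λ j → anyPermutation? (resp ∘ insert-cong zero j) (P? ∘ insert zero j))

transpose-left : (i j : Fin n) → PC.transpose i j i ≡ j
transpose-left i j rewrite dec-true (i ≟ i) refl = refl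

transpose-elim : (P : Fin n → Fin n → Set p) (i j : Fin n) → P i j → P j i → (∀ k → P k k) →
                 ∀ k → P k (PC.transpose i j k)
transpose-elim P i j pij pji pkk k with k ≟ i
... | yes refl = pij
... | no _ with k ≟ j
...   | yes refl = pji
...   | no _     = pkk k

record IsPerfectMatching (G : Matrix n) (π : Permutation′ n) : Set where
  constructor isPerfectMatching
  field matched : ∀ i → G i (π ⟨$⟩ʳ i) ≡ true

open IsPerfectMatching

isPerfectMatching? : (G : Matrix n) → Decidable (IsPerfectMatching G)
isPerfectMatching? G π = map′ isPerfectMatching matched (all? λ i → G i (π ⟨$⟩ʳ i) ≟ᵇ true)

isPerfectMatching-resp-≈ : (G : Matrix n) {σ ρ : Permutation′ n} →
                           σ ≈ ρ → IsPerfectMatching G σ → IsPerfectMatching G ρ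
isPerfectMatching-resp-≈ G σ≈ρ m =
  isPerfectMatching λ i → subst (λ j → G i j ≡ true) (σ≈ρ i) (matched m i)

hasPerfectMatching? : (G : Matrix n) → Dec (∃ (IsPerfectMatching G))
hasPerfectMatching? G = anyPermutation? (isPerfectMatching-resp-≈ G) (isPerfectMatching? G)

UniquelyMatchable : Matrix n → Set
UniquelyMatchable G = ∃ λ π → IsPerfectMatching G π × (∀ σ → IsPerfectMatching G σ → σ ≈ π)

edgeCount-uniquelyMatchable : (G : Matrix n) → UniquelyMatchable G → 2 * edgeCount G ≤ n * suc n
edgeCount-uniquelyMatchable {n} G (π , matches , unique) = begin
  2 * edgeCount G   ≡⟨ cong (2 *_) (edgeCount-permuteColumns π G) ⟩
  2 * edgeCount H   ≤⟨ edgeCount-antisymmetric H antisym ⟩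
  n * suc n         ∎
  where
  open ≤-Reasoning
  H : Matrix n
  H i j = G i (π ⟨$⟩ʳ j)
  -- Otherwise the matching that swaps the partners of i and j is a second one.
  antisym : ∀ i j → H i j ≡ true → H j i ≡ true → i ≡ j
  antisym i j hij hji = sym (Injection.injective (↔⇒↣ π)
    (trans (cong (π ⟨$⟩ʳ_) (sym (transpose-left i j))) (unique (transpose i j ∘ₚ π) swapped i)))
    where
    swapped : IsPerfectMatching G (transpose i j ∘ₚ π)
    swapped = isPerfectMatching (transpose-elim (λ k l → H k l ≡ true) i j hij hji (matched matches))

_⊆_ : Matrix n → Matrix n → Set
H ⊆ G = ∀ i j → H i j ≡ true → G i j ≡ true

isPerfectMatching-⊆ : {H G : Matrix n} {π : Permutation′ n} →
                      H ⊆ G → IsPerfectMatching H π → IsPerfectMatching G π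
isPerfectMatching-⊆ H⊆G m = isPerfectMatching λ i → H⊆G i _ (matched m i)

removeEdge : Fin n → Fin n → Matrix n → Matrix n
removeEdge a b G i j with i ≟ a | j ≟ b
... | yes _ | yes _ = false
... | _     | _     = G i j

removeEdge-⊆ : (a b : Fin n) (G : Matrix n) → removeEdge a b G ⊆ G
removeEdge-⊆ a b G i j with i ≟ a | j ≟ b
... | yes _ | yes _ = λ ()
... | no _  | _     = λ e → e
... | yes _ | no _  = λ e → e

removeEdge-self : (a b : Fin n) (G : Matrix n) → removeEdge a b G a b ≡ false
removeEdge-self a b G with a ≟ a | b ≟ b
... | yes _  | yes _  = refl
... | no a≢a | _      = contradiction refl a≢a
... | yes _  | no b≢b = contradiction refl b≢b

removeEdge-≢ : (a b : Fin n) (G : Matrix n) {i j : Fin n} →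
               (i ≡ a → j ≢ b) → removeEdge a b G i j ≡ G i j
removeEdge-≢ a b G {i} {j} ij≢ab with i ≟ a | j ≟ b
... | yes i≡a | yes j≡b = contradiction j≡b (ij≢ab i≡a)
... | no _    | _       = refl
... | yes _   | no _    = refl

removeEdge-unmatched : (a b : Fin n) (G : Matrix n) {π : Permutation′ n} →
                       IsPerfectMatching (removeEdge a b G) π → π ⟨$⟩ʳ a ≢ b
removeEdge-unmatched a b G m πa≡b = contradiction (trans (sym (removeEdge-self a b G)) abPresent) λ ()
  where
  abPresent : removeEdge a b G a b ≡ true
  abPresent = subst (λ j → removeEdge a b G a j ≡ true) πa≡b (matched m a)

removeEdge-matching : (a b : Fin n) (G : Matrix n) {π : Permutation′ n} →
                      IsPerfectMatching G π → π ⟨$⟩ʳ a ≢ b → IsPerfectMatching (removeEdge a b G) π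
removeEdge-matching a b G m πa≢b =
  isPerfectMatching λ i → trans (removeEdge-≢ a b G λ { refl → πa≢b }) (matched m i)

edgeCount-removeEdge : (a b : Fin n) (G : Matrix n) → edgeCount G ≤ suc (edgeCount (removeEdge a b G))
edgeCount-removeEdge a b G = sum-≤-suc (degree G) (degree G-ab) a
  (λ i i≢a → sum-mono-≤ _ _ λ j → unchanged i j λ i≡a → contradiction i≡a i≢a)
  (sum-≤-suc _ _ b (λ j j≢b → unchanged a j λ _ → j≢b) (≤-trans (boolToℕ≤1 (G a b)) (s≤s z≤n)))
  where
  G-ab = removeEdge a b G
  unchanged : ∀ i j → (i ≡ a → j ≢ b) → boolToℕ (G i j) ≤ boolToℕ (G-ab i j)
  unchanged i j ij≢ab = ≤-reflexive (cong boolToℕ (sym (removeEdge-≢ a b G ij≢ab)))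

permMatrix-≡ : (π : Permutation′ n) {i j : Fin n} → π ⟨$⟩ʳ i ≡ j → permMatrix π i j ≡ true
permMatrix-≡ π {i} {j} πi≡j with π ⟨$⟩ʳ i ≟ j
... | yes _    = refl
... | no πi≢j = contradiction πi≡j πi≢j

permMatrix-≢ : (π : Permutation′ n) {i j : Fin n} → π ⟨$⟩ʳ i ≢ j → permMatrix π i j ≡ false
permMatrix-≢ π {i} {j} πi≢j with π ⟨$⟩ʳ i ≟ j
... | yes πi≡j = contradiction πi≡j πi≢j
... | no _     = refl

permMatrix-true : (π : Permutation′ n) {i j : Fin n} → permMatrix π i j ≡ true → π ⟨$⟩ʳ i ≡ j
permMatrix-true π {i} {j} _ with π ⟨$⟩ʳ i ≟ j
permMatrix-true π _  | yes πi≡j = πi≡j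
permMatrix-true π () | no _

permMatrix-injective : (σ π : Permutation′ n) → (∀ i j → permMatrix σ i j ≡ permMatrix π i j) → σ ≈ π
permMatrix-injective σ π same i =
  sym (permMatrix-true π (trans (sym (same i (σ ⟨$⟩ʳ i))) (permMatrix-≡ σ refl)))

LearnsOn : QueryAlg n → Matrix n → Set
LearnsOn T G = ∀ π → IsPerfectMatching G π → ∀ i j → run T (permMatrix π) i j ≡ permMatrix π i j

learnsOn-⊆ : {T : QueryAlg n} {H G : Matrix n} → H ⊆ G → LearnsOn T G → LearnsOn T H
learnsOn-⊆ H⊆G learns π m = learns π (isPerfectMatching-⊆ H⊆G m)

learnsOn-query : {G : Matrix n} {a b : Fin n} {k : Bool → QueryAlg n} {x : Bool} →
                 (∀ π → IsPerfectMatching G π → permMatrix π a b ≡ x) →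
                 LearnsOn (query a b k) G → LearnsOn (k x) G
learnsOn-query {k = k} consistent learns π m i j =
  subst (λ y → run (k y) (permMatrix π) i j ≡ permMatrix π i j) (consistent π m) (learns π m i j)

learnsOn-output : {X : Matrix n} {G : Matrix n} {π : Permutation′ n} →
                  LearnsOn (output X) G → IsPerfectMatching G π → UniquelyMatchable G
learnsOn-output {π = π} learns m =
  π , m , λ σ mσ → permMatrix-injective σ π λ i j → trans (sym (learns σ mσ i j)) (learns π m i j)

record Reply (G : Matrix n) (a b : Fin n) : Set where
  field
    answer      : Bool
    remaining   : Matrix n
    remaining⊆G : remaining ⊆ G
    matching    : Permutation′ n
    matches     : IsPerfectMatching remaining matching
    consistent  : ∀ π → IsPerfectMatching remaining π → permMatrix π a b ≡ answer
    edgeCount≤  : edgeCount G ≤ suc (edgeCount remaining)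

reply : (G : Matrix n) (a b : Fin n) {π₀ : Permutation′ n} → IsPerfectMatching G π₀ → Reply G a b
reply G a b {π₀} m₀ with hasPerfectMatching? (removeEdge a b G)
... | yes (π₁ , m₁) = record
  { answer      = false
  ; remaining   = removeEdge a b G
  ; remaining⊆G = removeEdge-⊆ a b G
  ; matching    = π₁
  ; matches     = m₁
  ; consistent  = λ π m → permMatrix-≢ π (removeEdge-unmatched a b G m)
  ; edgeCount≤  = edgeCount-removeEdge a b G
  }
... | no none = record
  { answer      = true
  ; remaining   = G
  ; remaining⊆G = λ _ _ e → e
  ; matching    = π₀
  ; matches     = m₀
  ; consistent  = λ π m → permMatrix-≡ π (decidable-stable (π ⟨$⟩ʳ a ≟ b) λ πa≢b →
                                          none (π , removeEdge-matching a b G m πa≢b))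
  ; edgeCount≤  = n≤1+n _
  }

adversary : (T : QueryAlg n) (G : Matrix n) {π₀ : Permutation′ n} →
            IsPerfectMatching G π₀ → LearnsOn T G →
            ∃ λ π → IsPerfectMatching G π ×
              Σ[ U ∈ Matrix n ] UniquelyMatchable U × edgeCount G ≤ numQueries T (permMatrix π) + edgeCount U
adversary (output X) G {π₀} m₀ learns = π₀ , m₀ , G , learnsOn-output learns m₀ , ≤-refl
adversary (query a b k) G m₀ learns =
  let open Reply (reply G a b m₀)
      (π , m , U , unique , bound) =
        adversary (k answer) remaining matches
          (learnsOn-query {k = k} consistent (learnsOn-⊆ {T = query a b k} remaining⊆G learns))
      queries x = numQueries (k x) (permMatrix π)
      open ≤-Reasoning
  in π , isPerfectMatching-⊆ remaining⊆G m , U , unique , (begin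
       edgeCount G                                             ≤⟨ edgeCount≤ ⟩
       suc (edgeCount remaining)                               ≤⟨ s≤s bound ⟩
       suc (queries answer + edgeCount U)                      ≡⟨ cong (λ x → suc (queries x) + edgeCount U) (consistent π m) ⟨
       numQueries (query a b k) (permMatrix π) + edgeCount U   ∎)

triangular-bound : ∀ n q e → n * n ≤ q + e → 2 * e ≤ n * suc n → n * (n ∸ 1) / 2 ≤ q
triangular-bound n q e n²≤q+e 2e≤ = begin
  n * (n ∸ 1) / 2   ≤⟨ /-monoˡ-≤ 2 n[n∸1]≤2q ⟩
  2 * q / 2         ≡⟨ cong (_/ 2) (*-comm 2 q) ⟩
  q * 2 / 2         ≡⟨ m*n/n≡m q 2 ⟩
  q                 ∎
  where
  open ≤-Reasoning
  neighbours : ∀ n → n * (n ∸ 1) + n * suc n ≡ 2 * (n * n)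
  neighbours zero    = refl
  neighbours (suc m) = expand m
    where
    expand : ∀ m → suc m * m + suc m * suc (suc m) ≡ 2 * (suc m * suc m)
    expand = solve-∀
  n[n∸1]≤2q : n * (n ∸ 1) ≤ 2 * q
  n[n∸1]≤2q = +-cancelʳ-≤ (n * suc n) _ _ (begin
    n * (n ∸ 1) + n * suc n   ≡⟨ neighbours n ⟩
    2 * (n * n)               ≤⟨ *-monoʳ-≤ 2 n²≤q+e ⟩
    2 * (q + e)               ≡⟨ *-distribˡ-+ 2 q e ⟩
    2 * q + 2 * e             ≤⟨ +-monoʳ-≤ (2 * q) 2e≤ ⟩
    2 * q + n * suc n         ∎)

-- The bound holds for n = 0 as well.
lemma3p2 : (n : ℕ) → 1 ≤ n → (A : QueryAlg n) → Learns A →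
    ∃ λ (π : Permutation′ n) → n * (n ∸ 1) / 2 ≤ numQueries A (permMatrix π)
lemma3p2 n _ A learns
  with π , _ , U , unique , bound ←
         adversary A complete (isPerfectMatching {π = id} λ _ → refl) (λ π _ → learns π)
  = π , triangular-bound n _ (edgeCount U)
          (subst (_≤ numQueries A (permMatrix π) + edgeCount U) (edgeCount-complete n) bound)
          (edgeCount-uniquelyMatchable U unique)
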